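{- For every integer $n\ge 0$ and all $y,z$, \[ \sum_{r=0}^{n}\tilde{w}_{n,r}(y)z^{r}=\sum_{r=0}^{n}\binom{n}{r}\phi_{r}\bigl((z-1)y\bigr)w_{n-r}(y) \quad\text{and}\quad \sum_{r=0}^{n}\tilde{w}_{n,r}(y)z^{r}=\sum_{r=0}^{n}\binom{n}{r}\phi_{r}(zy)\tilde{w}_{n-r}(y). \]
   Context: ${n\brace k}$ denotes the Stirling number of the second kind. $\phi_n(y)=\sum_{k=0}^n{n\brace k}y^k$ (exponential polynomials), $w_n(y)=\sum_{k=0}^n{n\brace k}k!y^k$ (geometric polynomials). $d_{k,r}$ is the number of permutations of a $k$-set with exactly $r$ fixed points ($d_{k,r}=\binom{k}{r}d_{k-r}$ for $k\ge r$, $0$ otherwise, $d_m=m!\sum_{i=0}^m(-1)^i/i!$); $\tilde{w}_{n,r}(y)=\sum_{k=0}^n{n\brace k}d_{k,r}y^k$ and $\tilde{w}_n(y)=\tilde{w}_{n,0}(y)$. -}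

module Defs where

open import Level using (Level)
open import Data.Nat using (ℕ; zero; suc; _∸_; _≤ᵇ_; _!) renaming (_+_ to _+ℕ_; _*_ to _*ℕ_)
open import Data.Nat.Combinatorics using (_C_; _P_)
open import Data.Integer using (ℤ; +_; -[1+_]) renaming (_+_ to _+ℤ_; _*_ to _*ℤ_; -_ to -ℤ_)
open import Data.Bool using (if_then_else_)
open import Algebra.Bundles using (CommutativeRing)

stirling2 : ℕ → ℕ → ℕ
stirling2 zero    zero    = 1
stirling2 zero    (suc k) = 0
stirling2 (suc n) zero    = 0
stirling2 (suc n) (suc k) = suc k *ℕ stirling2 n (suc k) +ℕ stirling2 n k

sgn : ℕ → ℤ
sgn zero          = + 1
sgn (suc zero)    = -[1+ 0 ]
sgn (suc (suc i)) = sgn i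

sumℤ : ℕ → (ℕ → ℤ) → ℤ
sumℤ zero    f = f zero
sumℤ (suc m) f = sumℤ m f +ℤ f (suc m)

-- derangement number d_m = m! * sum_{i=0}^m (-1)^i / i! = sum_{i=0}^m (-1)^i m!/i!
-- (m!/i! = m P (m ∸ i), the falling factorial, exact for i ≤ m)
derange : ℕ → ℤ
derange m = sumℤ m (λ i → sgn i *ℤ (+ (m P (m ∸ i))))

derangeFix : ℕ → ℕ → ℤ
derangeFix k r = if r ≤ᵇ k then (+ (k C r)) *ℤ derange (k ∸ r) else + 0

module Poly {c ℓ : Level} (R : CommutativeRing c ℓ) where
  open CommutativeRing R using (Carrier; _+_; _*_; -_; 0#; 1#)

  ofℕ : ℕ → Carrier
  ofℕ zero    = 0#
  ofℕ (suc n) = 1# + ofℕ n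

  ofℤ : ℤ → Carrier
  ofℤ (+ n)      = ofℕ n
  ofℤ -[1+ n ]   = - ofℕ (suc n)

  pow : Carrier → ℕ → Carrier
  pow x zero    = 1#
  pow x (suc n) = pow x n * x

  Σ≤ : ℕ → (ℕ → Carrier) → Carrier
  Σ≤ zero    f = f zero
  Σ≤ (suc n) f = Σ≤ n f + f (suc n)

  φ : ℕ → Carrier → Carrier
  φ n y = Σ≤ n (λ k → ofℕ (stirling2 n k) * pow y k)

  w : ℕ → Carrier → Carrier
  w n y = Σ≤ n (λ k → ofℕ (stirling2 n k *ℕ (k !)) * pow y k)

  w̃ : ℕ → ℕ → Carrier → Carrier
  w̃ n r y = Σ≤ n (λ k → (ofℕ (stirling2 n k) * ofℤ (derangeFix k r)) * pow y k)

  w̃₀ : ℕ → Carrier → Carrier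
  w̃₀ n y = w̃ n 0 y

{-# OPTIONS --safe #-}
module Submission where

open import Defs
open import Level using (Level)
open import Data.Nat using (ℕ; zero; suc; _∸_; _≤_; _<_; _≤′_; _!; _/_; _≤ᵇ_; z≤n; s≤s; ≤′-refl; ≤′-step)
open import Data.Nat.Combinatorics
  using (_C_; _P_; nPk≡n!/[n∸k]!; nCk≡n!/k![n-k]!; k![n∸k]!∣n!; k>n⇒nCk≡0; nCk+nC[k+1]≡[n+1]C[k+1])
open import Data.Product using (_,_)
open import Algebra.Bundles using (CommutativeRing)
import Data.Nat as ℕ
import Data.Nat.Properties as ℕ
import Data.Integer as ℤ
import Data.Integer.Properties as ℤ
open import Data.Nat.Divisibility using (∣-trans; m∣m*n)
open import Data.Nat.DivMod using (m/n*n≡m)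
open import Data.Bool using (true; false)
open import Function using (_∘_)
open import Relation.Binary.PropositionalEquality as ≡ using (_≡_)

-- Writing A(u) = Σ aₖ uᵏ/k! for the exponential generating function of a sequence a,
-- the Stirling transform Σₖ {n brace k} aₖ has egf A(eᵗ − 1), and binomial convolution ⋆
-- multiplies egfs; so the Stirling transform of a binomial convolution is the binomial
-- convolution of the Stirling transforms.  Now Σᵣ d_{k,r} zʳ = Σᵣ (k choose r) zʳ d_{k−r},
-- so the left-hand side is the Stirling transform of (zy)ʲ ⋆ d_m yᵐ; this gives the second
-- identity, since φ, w and w̃ are the Stirling transforms of xʲ, m! yᵐ and d_m yᵐ.  For the
-- first, d_m = Σᵢ (m choose i) (−1)ⁱ (m − i)!, and convolving with uʲ and then with vʲ is
-- convolving with (u + v)ʲ, so zʲ ⋆ d = (z − 1)ʲ ⋆ m!.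

falling≡binomial*factorial : ∀ {m i} → i ≤ m → (m P (m ∸ i)) ≡ (m C i) ℕ.* (m ∸ i) !
falling≡binomial*factorial {m} {i} i≤m = ℕ.*-cancelʳ-≡ _ _ (i !) (begin
  (m P (m ∸ i)) ℕ.* i !                             ≡⟨ ≡.cong (ℕ._* i !) (nPk≡n!/[n∸k]! (ℕ.m∸n≤m m i)) ⟩
  m ! / (m ∸ (m ∸ i)) ! ℕ.* i !                     ≡⟨ ≡.cong (λ k → (m ! / k !) {{k ℕ.!≢0}} ℕ.* i !) (ℕ.m∸[m∸n]≡n i≤m) ⟩
  m ! / i ! ℕ.* i !                                 ≡⟨ m/n*n≡m (∣-trans (m∣m*n ((m ∸ i) !)) (k![n∸k]!∣n! i≤m)) ⟩
  m !                                               ≡⟨ m/n*n≡m (k![n∸k]!∣n! i≤m) ⟨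
  m ! / (i ! ℕ.* (m ∸ i) !) ℕ.* (i ! ℕ.* (m ∸ i) !) ≡⟨ ≡.cong (ℕ._* (i ! ℕ.* (m ∸ i) !)) (nCk≡n!/k![n-k]! i≤m) ⟨
  (m C i) ℕ.* (i ! ℕ.* (m ∸ i) !)                   ≡⟨ ≡.cong ((m C i) ℕ.*_) (ℕ.*-comm (i !) ((m ∸ i) !)) ⟩
  (m C i) ℕ.* ((m ∸ i) ! ℕ.* i !)                   ≡⟨ ℕ.*-assoc (m C i) ((m ∸ i) !) (i !) ⟨
  (m C i) ℕ.* (m ∸ i) ! ℕ.* i !                     ∎)
  where
  open ≡.≡-Reasoning
  instance
    _ = i ℕ.!≢0
    _ = i ℕ.!* (m ∸ i) !≢0
    _ = (m ∸ (m ∸ i)) ℕ.!≢0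

n<k⇒stirling2≡0 : ∀ {n k} → n < k → stirling2 n k ≡ 0
n<k⇒stirling2≡0 {zero}  {suc k} _         = ≡.refl
n<k⇒stirling2≡0 {suc n} {suc k} (s≤s n<k)
  rewrite n<k⇒stirling2≡0 (ℕ.m<n⇒m<1+n n<k) | n<k⇒stirling2≡0 n<k | ℕ.*-zeroʳ k = ≡.refl

derangeFix≡binomial*derange : ∀ k r → derangeFix k r ≡ ℤ.+ (k C r) ℤ.* derange (k ∸ r)
-- _C_ also branches on r ≤ᵇ k, so both cases hold by computation.
derangeFix≡binomial*derange k r with r ≤ᵇ k
... | true  = ≡.refl
... | false = ≡.refl

module _ {c ℓ : Level} (R : CommutativeRing c ℓ) where
  open CommutativeRing R
  open Poly R
  open import Relation.Binary.Reasoning.Setoid setoid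
  open import Algebra.Solver.Ring.NaturalCoefficients.Default commutativeSemiring
  open import Algebra.Properties.Ring ring using (-‿distribˡ-*; -‿distribʳ-*; -‿involutive; -0#≈0#; -‿+-comm; -1*x≈-x)
  open import Algebra.Properties.Semiring.Mult semiring using (_×_; ×-homo-+; ×1-homo-*)

  Σ≤-cong : ∀ n {f g : ℕ → Carrier} → (∀ i → f i ≈ g i) → Σ≤ n f ≈ Σ≤ n g
  Σ≤-cong zero    f≈g = f≈g 0
  Σ≤-cong (suc n) f≈g = +-cong (Σ≤-cong n f≈g) (f≈g (suc n))

  Σ≤-cong-≤ : ∀ n {f g : ℕ → Carrier} → (∀ {i} → i ≤ n → f i ≈ g i) → Σ≤ n f ≈ Σ≤ n g
  Σ≤-cong-≤ zero    f≈g = f≈g z≤n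
  Σ≤-cong-≤ (suc n) f≈g = +-cong (Σ≤-cong-≤ n (f≈g ∘ ℕ.m≤n⇒m≤1+n)) (f≈g ℕ.≤-refl)

  Σ≤-distrib-+ : ∀ n (f g : ℕ → Carrier) → Σ≤ n (λ i → f i + g i) ≈ Σ≤ n f + Σ≤ n g
  Σ≤-distrib-+ zero    f g = refl
  Σ≤-distrib-+ (suc n) f g = begin
    Σ≤ n (λ i → f i + g i) + (f (suc n) + g (suc n))   ≈⟨ +-congʳ (Σ≤-distrib-+ n f g) ⟩
    (Σ≤ n f + Σ≤ n g) + (f (suc n) + g (suc n))        ≈⟨ solve 4 (λ a b x y → (a :+ b) :+ (x :+ y) := (a :+ x) :+ (b :+ y))
                                                             refl (Σ≤ n f) (Σ≤ n g) (f (suc n)) (g (suc n)) ⟩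
    (Σ≤ n f + f (suc n)) + (Σ≤ n g + g (suc n))        ∎

  *-distribˡ-Σ≤ : ∀ n a (f : ℕ → Carrier) → a * Σ≤ n f ≈ Σ≤ n (λ i → a * f i)
  *-distribˡ-Σ≤ zero    a f = refl
  *-distribˡ-Σ≤ (suc n) a f = trans (distribˡ a (Σ≤ n f) (f (suc n))) (+-congʳ (*-distribˡ-Σ≤ n a f))

  *-distribʳ-Σ≤ : ∀ n a (f : ℕ → Carrier) → Σ≤ n f * a ≈ Σ≤ n (λ i → f i * a)
  *-distribʳ-Σ≤ n a f = trans (*-comm _ a) (trans (*-distribˡ-Σ≤ n a f) (Σ≤-cong n (λ i → *-comm a (f i))))

  Σ≤-suc : ∀ n (f : ℕ → Carrier) → Σ≤ (suc n) f ≈ f 0 + Σ≤ n (f ∘ suc)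
  Σ≤-suc zero    f = refl
  Σ≤-suc (suc n) f = trans (+-congʳ (Σ≤-suc n f)) (+-assoc _ _ _)

  Σ≤-comm : ∀ n m (f : ℕ → ℕ → Carrier) → Σ≤ n (λ i → Σ≤ m (f i)) ≈ Σ≤ m (λ j → Σ≤ n (λ i → f i j))
  Σ≤-comm zero    m f = refl
  Σ≤-comm (suc n) m f = trans (+-congʳ (Σ≤-comm n m f)) (sym (Σ≤-distrib-+ m _ (f (suc n))))

  Σ≤-truncate : ∀ {k n} (f : ℕ → Carrier) → (∀ {i} → k < i → f i ≈ 0#) → k ≤′ n → Σ≤ n f ≈ Σ≤ k f
  Σ≤-truncate f f≈0 ≤′-refl        = refl
  Σ≤-truncate f f≈0 (≤′-step k≤′n) =
    trans (+-cong (Σ≤-truncate f f≈0 k≤′n) (f≈0 (s≤s (ℕ.≤′⇒≤ k≤′n)))) (+-identityʳ _)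

  Σ≤-unshift : ∀ n (f : ℕ → Carrier) → f 0 ≈ 0# → f (suc n) ≈ 0# → Σ≤ n (f ∘ suc) ≈ Σ≤ n f
  Σ≤-unshift n f f0≈0 f[1+n]≈0 = begin
    Σ≤ n (f ∘ suc)        ≈⟨ +-identityˡ _ ⟨
    0# + Σ≤ n (f ∘ suc)   ≈⟨ +-congʳ f0≈0 ⟨
    f 0 + Σ≤ n (f ∘ suc)  ≈⟨ Σ≤-suc n f ⟨
    Σ≤ n f + f (suc n)    ≈⟨ +-congˡ f[1+n]≈0 ⟩
    Σ≤ n f + 0#           ≈⟨ +-identityʳ _ ⟩
    Σ≤ n f                ∎

  ofℕ≡×1# : ∀ n → ofℕ n ≡ n × 1#
  ofℕ≡×1# zero    = ≡.refl
  ofℕ≡×1# (suc n) = ≡.cong (1# +_) (ofℕ≡×1# n)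

  ofℕ-homo-+ : ∀ m n → ofℕ (m ℕ.+ n) ≈ ofℕ m + ofℕ n
  ofℕ-homo-+ m n rewrite ofℕ≡×1# m | ofℕ≡×1# n | ofℕ≡×1# (m ℕ.+ n) = ×-homo-+ 1# m n

  ofℕ-homo-* : ∀ m n → ofℕ (m ℕ.* n) ≈ ofℕ m * ofℕ n
  ofℕ-homo-* m n rewrite ofℕ≡×1# m | ofℕ≡×1# n | ofℕ≡×1# (m ℕ.* n) = ×1-homo-* m n

  ofℕ-1 : ofℕ 1 ≈ 1#
  ofℕ-1 = +-identityʳ 1#

  Σ≤-pascal : ∀ n (F : ℕ → ℕ → Carrier) →
    Σ≤ (suc n) (λ r → ofℕ (suc n C r) * F r (suc n ∸ r))
      ≈ Σ≤ n (λ r → ofℕ (n C r) * F (suc r) (n ∸ r)) + Σ≤ n (λ r → ofℕ (n C r) * F r (suc (n ∸ r)))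
  Σ≤-pascal n F = begin
    Σ≤ (suc n) (λ r → ofℕ (suc n C r) * F r (suc n ∸ r))   ≈⟨ Σ≤-suc n _ ⟩
    B 0 + Σ≤ n (λ r → ofℕ (suc n C suc r) * F (suc r) (n ∸ r))
      ≈⟨ +-congˡ (Σ≤-cong n (λ r → trans (*-congʳ (pascal r)) (distribʳ _ _ _))) ⟩
    B 0 + Σ≤ n (λ r → A r + B (suc r))                    ≈⟨ +-congˡ (Σ≤-distrib-+ n A (B ∘ suc)) ⟩
    B 0 + (Σ≤ n A + Σ≤ n (B ∘ suc))                       ≈⟨ solve 3 (λ x y z → x :+ (y :+ z) := y :+ (x :+ z)) refl _ _ _ ⟩
    Σ≤ n A + (B 0 + Σ≤ n (B ∘ suc))                       ≈⟨ +-congˡ (Σ≤-suc n B) ⟨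
    Σ≤ n A + (Σ≤ n B + B (suc n))                         ≈⟨ +-congˡ (+-congˡ B[1+n]≈0) ⟩
    Σ≤ n A + (Σ≤ n B + 0#)                                ≈⟨ +-congˡ (+-identityʳ _) ⟩
    Σ≤ n A + Σ≤ n B
      ≈⟨ +-congˡ (Σ≤-cong-≤ n (λ {r} r≤n → *-congˡ (reflexive (≡.cong (F r) (ℕ.+-∸-assoc 1 r≤n))))) ⟩
    Σ≤ n A + Σ≤ n (λ r → ofℕ (n C r) * F r (suc (n ∸ r))) ∎
    where
    A B : ℕ → Carrier
    A r = ofℕ (n C r) * F (suc r) (n ∸ r)
    -- B 0 is also the r = 0 term on the left, as n C 0 and suc n C 0 both compute to 1.
    B r = ofℕ (n C r) * F r (suc n ∸ r)
    pascal : ∀ r → ofℕ (suc n C suc r) ≈ ofℕ (n C r) + ofℕ (n C suc r)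
    pascal r = trans (reflexive (≡.cong ofℕ (≡.sym (nCk+nC[k+1]≡[n+1]C[k+1] n r)))) (ofℕ-homo-+ (n C r) (n C suc r))
    B[1+n]≈0 : B (suc n) ≈ 0#
    B[1+n]≈0 = trans (*-congʳ (reflexive (≡.cong ofℕ (k>n⇒nCk≡0 (ℕ.n<1+n n))))) (zeroˡ _)

  ofℤ-neg : ∀ i → ofℤ (ℤ.- i) ≈ - ofℤ i
  ofℤ-neg (ℤ.+ zero)  = sym -0#≈0#
  ofℤ-neg (ℤ.+ suc n) = refl
  ofℤ-neg ℤ.-[1+ n ]  = sym (-‿involutive _)

  ofℤ-⊖ : ∀ m n → ofℤ (m ℤ.⊖ n) ≈ ofℕ m - ofℕ n
  ofℤ-⊖ m       zero    = sym (trans (+-congˡ -0#≈0#) (+-identityʳ _))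
  ofℤ-⊖ zero    (suc n) = sym (+-identityˡ _)
  ofℤ-⊖ (suc m) (suc n) = begin
    ofℤ (suc m ℤ.⊖ suc n)             ≡⟨ ≡.cong ofℤ (ℤ.[1+m]⊖[1+n]≡m⊖n m n) ⟩
    ofℤ (m ℤ.⊖ n)                     ≈⟨ ofℤ-⊖ m n ⟩
    ofℕ m - ofℕ n                     ≈⟨ +-identityˡ _ ⟨
    0# + (ofℕ m - ofℕ n)              ≈⟨ +-congʳ (-‿inverseʳ 1#) ⟨
    (1# - 1#) + (ofℕ m - ofℕ n)
      ≈⟨ solve 4 (λ o x no ny → (o :+ no) :+ (x :+ ny) := (o :+ x) :+ (no :+ ny)) refl 1# (ofℕ m) (- 1#) (- ofℕ n) ⟩
    (1# + ofℕ m) + (- 1# + - ofℕ n)   ≈⟨ +-congˡ (-‿+-comm 1# (ofℕ n)) ⟩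
    (1# + ofℕ m) - (1# + ofℕ n)       ∎

  ofℤ-homo-+ : ∀ i j → ofℤ (i ℤ.+ j) ≈ ofℤ i + ofℤ j
  ofℤ-homo-+ (ℤ.+ m)    (ℤ.+ n)    = ofℕ-homo-+ m n
  ofℤ-homo-+ (ℤ.+ m)    ℤ.-[1+ n ] = ofℤ-⊖ m (suc n)
  ofℤ-homo-+ ℤ.-[1+ m ] (ℤ.+ n)    = trans (ofℤ-⊖ n (suc m)) (+-comm _ _)
  ofℤ-homo-+ ℤ.-[1+ m ] ℤ.-[1+ n ] = begin
    - ofℕ (suc (suc (m ℕ.+ n)))     ≡⟨ ≡.cong (λ t → - ofℕ (suc t)) (ℕ.+-suc m n) ⟨
    - ofℕ (suc m ℕ.+ suc n)         ≈⟨ -‿cong (ofℕ-homo-+ (suc m) (suc n)) ⟩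
    - (ofℕ (suc m) + ofℕ (suc n))   ≈⟨ -‿+-comm _ _ ⟨
    - ofℕ (suc m) + - ofℕ (suc n)   ∎

  ofℤ-pos-* : ∀ m j → ofℤ (ℤ.+ m ℤ.* j) ≈ ofℕ m * ofℤ j
  ofℤ-pos-* m (ℤ.+ n)    = trans (reflexive (≡.cong ofℤ (≡.sym (ℤ.pos-* m n)))) (ofℕ-homo-* m n)
  ofℤ-pos-* m ℤ.-[1+ n ] = begin
    ofℤ (ℤ.+ m ℤ.* ℤ.-[1+ n ])         ≡⟨ ≡.cong ofℤ (ℤ.neg-distribʳ-* (ℤ.+ m) (ℤ.+ suc n)) ⟨
    ofℤ (ℤ.- (ℤ.+ m ℤ.* ℤ.+ suc n))    ≈⟨ ofℤ-neg (ℤ.+ m ℤ.* ℤ.+ suc n) ⟩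
    - ofℤ (ℤ.+ m ℤ.* ℤ.+ suc n)        ≈⟨ -‿cong (ofℤ-pos-* m (ℤ.+ suc n)) ⟩
    - (ofℕ m * ofℕ (suc n))            ≈⟨ -‿distribʳ-* _ _ ⟩
    ofℕ m * - ofℕ (suc n)              ∎

  ofℤ-homo-* : ∀ i j → ofℤ (i ℤ.* j) ≈ ofℤ i * ofℤ j
  ofℤ-homo-* (ℤ.+ m)    j = ofℤ-pos-* m j
  ofℤ-homo-* ℤ.-[1+ m ] j = begin
    ofℤ (ℤ.-[1+ m ] ℤ.* j)             ≡⟨ ≡.cong ofℤ (ℤ.neg-distribˡ-* (ℤ.+ suc m) j) ⟨
    ofℤ (ℤ.- (ℤ.+ suc m ℤ.* j))        ≈⟨ ofℤ-neg (ℤ.+ suc m ℤ.* j) ⟩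
    - ofℤ (ℤ.+ suc m ℤ.* j)            ≈⟨ -‿cong (ofℤ-pos-* (suc m) j) ⟩
    - (ofℕ (suc m) * ofℤ j)            ≈⟨ -‿distribˡ-* _ _ ⟩
    - ofℕ (suc m) * ofℤ j              ∎

  ofℤ-sumℤ : ∀ m (f : ℕ → ℤ.ℤ) → ofℤ (sumℤ m f) ≈ Σ≤ m (ofℤ ∘ f)
  ofℤ-sumℤ zero    f = refl
  ofℤ-sumℤ (suc m) f = trans (ofℤ-homo-+ (sumℤ m f) (f (suc m))) (+-congʳ (ofℤ-sumℤ m f))

  ofℤ-sgn : ∀ i → ofℤ (sgn i) ≈ pow (- 1#) i
  ofℤ-sgn zero          = ofℕ-1
  ofℤ-sgn (suc zero)    = trans (-‿cong ofℕ-1) (sym (*-identityˡ _))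
  ofℤ-sgn (suc (suc i)) = begin
    ofℤ (sgn i)                           ≈⟨ ofℤ-sgn i ⟩
    pow (- 1#) i                          ≈⟨ *-identityʳ _ ⟨
    pow (- 1#) i * 1#                     ≈⟨ *-congˡ (trans (-1*x≈-x (- 1#)) (-‿involutive 1#)) ⟨
    pow (- 1#) i * (- 1# * - 1#)          ≈⟨ *-assoc _ _ _ ⟨
    pow (- 1#) i * - 1# * - 1#            ∎

  pow-distrib-* : ∀ x y n → pow (x * y) n ≈ pow x n * pow y n
  pow-distrib-* x y zero    = sym (*-identityˡ 1#)
  pow-distrib-* x y (suc n) = trans (*-congʳ (pow-distrib-* x y n))
    (solve 4 (λ a b x y → (a :* b) :* (x :* y) := (a :* x) :* (b :* y)) refl _ _ x y)

  pow-homo-+ : ∀ x m n → pow x (m ℕ.+ n) ≈ pow x m * pow x n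
  pow-homo-+ x zero    n = sym (*-identityˡ _)
  pow-homo-+ x (suc m) n = trans (*-congʳ (pow-homo-+ x m n))
    (solve 3 (λ a b x → (a :* b) :* x := (a :* x) :* b) refl _ _ x)

  Seq : Set c
  Seq = ℕ → Carrier

  infix  4 _≋_
  infixl 6 _⊕_
  infixl 7 _⋆_
  infixr 7 _·_

  _≋_ : Seq → Seq → Set ℓ
  a ≋ b = ∀ k → a k ≈ b k

  _⊕_ : Seq → Seq → Seq
  (a ⊕ b) k = a k + b k

  _·_ : Carrier → Seq → Seq
  (s · a) k = s * a k

  _⋆_ : Seq → Seq → Seq
  (a ⋆ b) k = Σ≤ k (λ j → ofℕ (k C j) * (a j * b (k ∸ j)))

  dilate : Carrier → Seq → Seq
  dilate y a k = a k * pow y k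

  -- On egfs, θ is u d/du, a ∘ suc is d/du, and ∂ is (1 + u) d/du: the derivative in t
  -- after substituting u = eᵗ − 1.
  θ : Seq → Seq
  θ a k = ofℕ k * a k

  ∂ : Seq → Seq
  ∂ a = θ a ⊕ a ∘ suc

  ∂^ : ℕ → Seq → Seq
  ∂^ zero    a = a
  ∂^ (suc n) a = ∂ (∂^ n a)

  stirlingTransform : Seq → Seq
  stirlingTransform a n = Σ≤ n (λ k → ofℕ (stirling2 n k) * a k)

  ⋆-congˡ : ∀ {a a′} b → a ≋ a′ → a ⋆ b ≋ a′ ⋆ b
  ⋆-congˡ b a≋a′ k = Σ≤-cong k (λ j → *-congˡ (*-congʳ (a≋a′ j)))

  ⋆-congʳ : ∀ a {b b′} → b ≋ b′ → a ⋆ b ≋ a ⋆ b′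
  ⋆-congʳ a b≋b′ k = Σ≤-cong k (λ j → *-congˡ (*-congˡ (b≋b′ (k ∸ j))))

  ⋆-distribʳ-⊕ : ∀ a a′ b → (a ⊕ a′) ⋆ b ≋ a ⋆ b ⊕ a′ ⋆ b
  ⋆-distribʳ-⊕ a a′ b k =
    trans (Σ≤-cong k (λ j → trans (*-congˡ (distribʳ _ _ _)) (distribˡ _ _ _))) (Σ≤-distrib-+ k _ _)

  ⋆-distribˡ-⊕ : ∀ a b b′ → a ⋆ (b ⊕ b′) ≋ a ⋆ b ⊕ a ⋆ b′
  ⋆-distribˡ-⊕ a b b′ k =
    trans (Σ≤-cong k (λ j → trans (*-congˡ (distribˡ _ _ _)) (distribˡ _ _ _))) (Σ≤-distrib-+ k _ _)

  ·-⋆-assoc : ∀ s a b → (s · a) ⋆ b ≋ s · (a ⋆ b)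
  ·-⋆-assoc s a b k = trans
    (Σ≤-cong k (λ j → solve 4 (λ c x s y → c :* ((s :* x) :* y) := s :* (c :* (x :* y))) refl _ (a j) s _))
    (sym (*-distribˡ-Σ≤ k s _))

  ⋆-·-comm : ∀ s a b → a ⋆ (s · b) ≋ s · (a ⋆ b)
  ⋆-·-comm s a b k = trans
    (Σ≤-cong k (λ j → solve 4 (λ c x s y → c :* (x :* (s :* y)) := s :* (c :* (x :* y))) refl _ (a j) s _))
    (sym (*-distribˡ-Σ≤ k s _))

  ⋆-at-zero : ∀ a b → (a ⋆ b) 0 ≈ a 0 * b 0
  ⋆-at-zero a b = trans (*-congʳ ofℕ-1) (*-identityˡ _)

  ⋆-suc : ∀ a b k → (a ⋆ b) (suc k) ≈ ((a ∘ suc) ⋆ b) k + (a ⋆ (b ∘ suc)) k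
  ⋆-suc a b k = Σ≤-pascal k (λ i j → a i * b j)

  θ-⋆ : ∀ a b → θ (a ⋆ b) ≋ θ a ⋆ b ⊕ a ⋆ θ b
  θ-⋆ a b k = begin
    ofℕ k * (a ⋆ b) k
      ≈⟨ *-distribˡ-Σ≤ k _ _ ⟩
    Σ≤ k (λ j → ofℕ k * (ofℕ (k C j) * (a j * b (k ∸ j))))
      ≈⟨ Σ≤-cong-≤ k (λ {j} j≤k → trans (*-congʳ (split j≤k))
           (solve 5 (λ J K c x y → (J :+ K) :* (c :* (x :* y)) := c :* ((J :* x) :* y) :+ c :* (x :* (K :* y)))
                  refl _ _ _ _ _)) ⟩
    Σ≤ k (λ j → ofℕ (k C j) * (θ a j * b (k ∸ j)) + ofℕ (k C j) * (a j * θ b (k ∸ j)))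
      ≈⟨ Σ≤-distrib-+ k _ _ ⟩
    (θ a ⋆ b) k + (a ⋆ θ b) k ∎
    where
    split : ∀ {j} → j ≤ k → ofℕ k ≈ ofℕ j + ofℕ (k ∸ j)
    split {j} j≤k = trans (reflexive (≡.cong ofℕ (≡.sym (ℕ.m+[n∸m]≡n j≤k)))) (ofℕ-homo-+ j (k ∸ j))

  ∂-⋆ : ∀ a b → ∂ (a ⋆ b) ≋ ∂ a ⋆ b ⊕ a ⋆ ∂ b
  ∂-⋆ a b k = begin
    θ (a ⋆ b) k + (a ⋆ b) (suc k)
      ≈⟨ +-cong (θ-⋆ a b k) (⋆-suc a b k) ⟩
    ((θ a ⋆ b) k + (a ⋆ θ b) k) + (((a ∘ suc) ⋆ b) k + (a ⋆ (b ∘ suc)) k)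
      ≈⟨ solve 4 (λ p q r s → (p :+ q) :+ (r :+ s) := (p :+ r) :+ (q :+ s)) refl _ _ _ _ ⟩
    ((θ a ⋆ b) k + ((a ∘ suc) ⋆ b) k) + ((a ⋆ θ b) k + (a ⋆ (b ∘ suc)) k)
      ≈⟨ +-cong (⋆-distribʳ-⊕ (θ a) (a ∘ suc) b k) (⋆-distribˡ-⊕ a (θ b) (b ∘ suc) k) ⟨
    (∂ a ⋆ b) k + (a ⋆ ∂ b) k ∎

  ∂-cong : ∀ {a b} → a ≋ b → ∂ a ≋ ∂ b
  ∂-cong a≋b k = +-cong (*-congˡ (a≋b k)) (a≋b (suc k))

  ∂-Σ≤ : ∀ n (s : ℕ → Carrier) (V : ℕ → Seq) →
    ∂ (λ k → Σ≤ n (λ r → s r * V r k)) ≋ (λ k → Σ≤ n (λ r → s r * ∂ (V r) k))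
  ∂-Σ≤ n s V k = begin
    ofℕ k * Σ≤ n (λ r → s r * V r k) + Σ≤ n (λ r → s r * V r (suc k))
      ≈⟨ +-congʳ (*-distribˡ-Σ≤ n (ofℕ k) _) ⟩
    Σ≤ n (λ r → ofℕ k * (s r * V r k)) + Σ≤ n (λ r → s r * V r (suc k))
      ≈⟨ Σ≤-distrib-+ n _ _ ⟨
    Σ≤ n (λ r → ofℕ k * (s r * V r k) + s r * V r (suc k))
      ≈⟨ Σ≤-cong n (λ r → solve 4 (λ K c v w → K :* (c :* v) :+ c :* w := c :* (K :* v :+ w)) refl _ _ _ _) ⟩
    Σ≤ n (λ r → s r * ∂ (V r) k) ∎

  ∂^-∂ : ∀ n a → ∂^ n (∂ a) ≋ ∂ (∂^ n a)
  ∂^-∂ zero    a k = refl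
  ∂^-∂ (suc n) a   = ∂-cong (∂^-∂ n a)

  ∂^-⋆ : ∀ n a b → ∂^ n (a ⋆ b) ≋ (λ k → Σ≤ n (λ r → ofℕ (n C r) * (∂^ r a ⋆ ∂^ (n ∸ r) b) k))
  ∂^-⋆ zero    a b k = sym (trans (*-congʳ ofℕ-1) (*-identityˡ _))
  ∂^-⋆ (suc n) a b k = begin
    ∂ (∂^ n (a ⋆ b)) k
      ≈⟨ ∂-cong (∂^-⋆ n a b) k ⟩
    ∂ (λ k → Σ≤ n (λ r → ofℕ (n C r) * (∂^ r a ⋆ ∂^ (n ∸ r) b) k)) k
      ≈⟨ ∂-Σ≤ n (λ r → ofℕ (n C r)) (λ r → ∂^ r a ⋆ ∂^ (n ∸ r) b) k ⟩
    Σ≤ n (λ r → ofℕ (n C r) * ∂ (∂^ r a ⋆ ∂^ (n ∸ r) b) k)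
      ≈⟨ Σ≤-cong n (λ r → trans (*-congˡ (∂-⋆ (∂^ r a) (∂^ (n ∸ r) b) k)) (distribˡ _ _ _)) ⟩
    Σ≤ n (λ r → ofℕ (n C r) * F (suc r) (n ∸ r) + ofℕ (n C r) * F r (suc (n ∸ r)))
      ≈⟨ Σ≤-distrib-+ n _ _ ⟩
    Σ≤ n (λ r → ofℕ (n C r) * F (suc r) (n ∸ r)) + Σ≤ n (λ r → ofℕ (n C r) * F r (suc (n ∸ r)))
      ≈⟨ Σ≤-pascal n F ⟨
    Σ≤ (suc n) (λ r → ofℕ (suc n C r) * F r (suc n ∸ r)) ∎
    where
    F : ℕ → ℕ → Carrier
    F i j = (∂^ i a ⋆ ∂^ j b) k

  stirlingTransform-cong : ∀ n {a b} → a ≋ b → stirlingTransform a n ≈ stirlingTransform b n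
  stirlingTransform-cong n a≋b = Σ≤-cong n (λ k → *-congˡ (a≋b k))

  stirlingTransform-suc : ∀ n a → stirlingTransform a (suc n) ≈ stirlingTransform (∂ a) n
  stirlingTransform-suc n a = begin
    Σ≤ (suc n) (λ k → ofℕ (stirling2 (suc n) k) * a k)
      ≈⟨ Σ≤-suc n _ ⟩
    0# * a 0 + Σ≤ n (λ k → ofℕ (stirling2 (suc n) (suc k)) * a (suc k))
      ≈⟨ trans (+-congʳ (zeroˡ _)) (+-identityˡ _) ⟩
    Σ≤ n (λ k → ofℕ (suc k ℕ.* stirling2 n (suc k) ℕ.+ stirling2 n k) * a (suc k))
      ≈⟨ Σ≤-cong n recurrence ⟩
    Σ≤ n (λ k → h (suc k) + ofℕ (stirling2 n k) * a (suc k))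
      ≈⟨ Σ≤-distrib-+ n _ _ ⟩
    Σ≤ n (h ∘ suc) + Σ≤ n (λ k → ofℕ (stirling2 n k) * a (suc k))
      ≈⟨ +-congʳ (Σ≤-unshift n h h0≈0 h[1+n]≈0) ⟩
    Σ≤ n h + Σ≤ n (λ k → ofℕ (stirling2 n k) * a (suc k))
      ≈⟨ Σ≤-distrib-+ n _ _ ⟨
    Σ≤ n (λ k → h k + ofℕ (stirling2 n k) * a (suc k))
      ≈⟨ Σ≤-cong n (λ k → distribˡ _ _ _) ⟨
    stirlingTransform (∂ a) n ∎
    where
    h : ℕ → Carrier
    h k = ofℕ (stirling2 n k) * θ a k
    recurrence : ∀ k → ofℕ (suc k ℕ.* stirling2 n (suc k) ℕ.+ stirling2 n k) * a (suc k)
                         ≈ h (suc k) + ofℕ (stirling2 n k) * a (suc k)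
    recurrence k = begin
      ofℕ (suc k ℕ.* stirling2 n (suc k) ℕ.+ stirling2 n k) * a (suc k)
        ≈⟨ *-congʳ (trans (ofℕ-homo-+ (suc k ℕ.* stirling2 n (suc k)) (stirling2 n k))
                          (+-congʳ (ofℕ-homo-* (suc k) (stirling2 n (suc k))))) ⟩
      (ofℕ (suc k) * ofℕ (stirling2 n (suc k)) + ofℕ (stirling2 n k)) * a (suc k)
        ≈⟨ solve 4 (λ p q r x → (p :* q :+ r) :* x := q :* (p :* x) :+ r :* x) refl _ _ _ _ ⟩
      h (suc k) + ofℕ (stirling2 n k) * a (suc k) ∎
    h0≈0 : h 0 ≈ 0#
    h0≈0 = trans (*-congˡ (zeroˡ _)) (zeroʳ _)
    h[1+n]≈0 : h (suc n) ≈ 0#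
    h[1+n]≈0 = trans (*-congʳ (reflexive (≡.cong ofℕ (n<k⇒stirling2≡0 (ℕ.n<1+n n))))) (zeroˡ _)

  stirlingTransform≈∂^ : ∀ n a → stirlingTransform a n ≈ ∂^ n a 0
  stirlingTransform≈∂^ zero    a = trans (*-congʳ ofℕ-1) (*-identityˡ _)
  stirlingTransform≈∂^ (suc n) a = begin
    stirlingTransform a (suc n)   ≈⟨ stirlingTransform-suc n a ⟩
    stirlingTransform (∂ a) n     ≈⟨ stirlingTransform≈∂^ n (∂ a) ⟩
    ∂^ n (∂ a) 0                  ≈⟨ ∂^-∂ n a 0 ⟩
    ∂ (∂^ n a) 0                  ∎

  stirlingTransform-⋆ : ∀ n a b →
    stirlingTransform (a ⋆ b) n ≈ Σ≤ n (λ r → ofℕ (n C r) * stirlingTransform a r * stirlingTransform b (n ∸ r))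
  stirlingTransform-⋆ n a b = begin
    stirlingTransform (a ⋆ b) n
      ≈⟨ stirlingTransform≈∂^ n (a ⋆ b) ⟩
    ∂^ n (a ⋆ b) 0
      ≈⟨ ∂^-⋆ n a b 0 ⟩
    Σ≤ n (λ r → ofℕ (n C r) * (∂^ r a ⋆ ∂^ (n ∸ r) b) 0)
      ≈⟨ Σ≤-cong n (λ r → trans (*-congˡ (⋆-at-zero (∂^ r a) (∂^ (n ∸ r) b))) (sym (*-assoc _ _ _))) ⟩
    Σ≤ n (λ r → ofℕ (n C r) * ∂^ r a 0 * ∂^ (n ∸ r) b 0)
      ≈⟨ Σ≤-cong n (λ r → sym (*-cong (*-congˡ (stirlingTransform≈∂^ r a)) (stirlingTransform≈∂^ (n ∸ r) b))) ⟩
    Σ≤ n (λ r → ofℕ (n C r) * stirlingTransform a r * stirlingTransform b (n ∸ r)) ∎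

  pow-⋆-suc : ∀ u b k → (pow u ⋆ b) (suc k) ≈ u * (pow u ⋆ b) k + (pow u ⋆ (b ∘ suc)) k
  pow-⋆-suc u b k = trans (⋆-suc (pow u) b k)
    (+-congʳ (trans (⋆-congˡ b (λ j → *-comm (pow u j) u) k) (·-⋆-assoc u (pow u) b k)))

  pow-⋆-pow : ∀ u v b → pow u ⋆ (pow v ⋆ b) ≋ pow (u + v) ⋆ b
  pow-⋆-pow u v b zero = begin
    (pow u ⋆ (pow v ⋆ b)) 0     ≈⟨ ⋆-at-zero (pow u) (pow v ⋆ b) ⟩
    1# * (pow v ⋆ b) 0          ≈⟨ *-identityˡ _ ⟩
    (pow v ⋆ b) 0               ≈⟨ ⋆-at-zero (pow v) b ⟩
    1# * b 0                    ≈⟨ ⋆-at-zero (pow (u + v)) b ⟨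
    (pow (u + v) ⋆ b) 0         ∎
  pow-⋆-pow u v b (suc k) = begin
    (pow u ⋆ (pow v ⋆ b)) (suc k)
      ≈⟨ pow-⋆-suc u (pow v ⋆ b) k ⟩
    u * (pow u ⋆ (pow v ⋆ b)) k + (pow u ⋆ ((pow v ⋆ b) ∘ suc)) k
      ≈⟨ +-congˡ (⋆-congʳ (pow u) (pow-⋆-suc v b) k) ⟩
    u * (pow u ⋆ (pow v ⋆ b)) k + (pow u ⋆ (v · (pow v ⋆ b) ⊕ pow v ⋆ (b ∘ suc))) k
      ≈⟨ +-congˡ (trans (⋆-distribˡ-⊕ (pow u) (v · (pow v ⋆ b)) (pow v ⋆ (b ∘ suc)) k)
                        (+-congʳ (⋆-·-comm v (pow u) (pow v ⋆ b) k))) ⟩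
    u * (pow u ⋆ (pow v ⋆ b)) k + (v * (pow u ⋆ (pow v ⋆ b)) k + (pow u ⋆ (pow v ⋆ (b ∘ suc))) k)
      ≈⟨ +-cong (*-congˡ (pow-⋆-pow u v b k)) (+-cong (*-congˡ (pow-⋆-pow u v b k)) (pow-⋆-pow u v (b ∘ suc) k)) ⟩
    u * (pow (u + v) ⋆ b) k + (v * (pow (u + v) ⋆ b) k + (pow (u + v) ⋆ (b ∘ suc)) k)
      ≈⟨ solve 4 (λ u v x y → u :* x :+ (v :* x :+ y) := (u :+ v) :* x :+ y) refl u v _ _ ⟩
    (u + v) * (pow (u + v) ⋆ b) k + (pow (u + v) ⋆ (b ∘ suc)) k
      ≈⟨ pow-⋆-suc (u + v) b k ⟨
    (pow (u + v) ⋆ b) (suc k) ∎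
    where
    IH : (pow u ⋆ (pow v ⋆ b)) k ≈ (pow (u + v) ⋆ b) k
    IH = pow-⋆-pow u v b k

  dilate-cong : ∀ y {a b} → a ≋ b → dilate y a ≋ dilate y b
  dilate-cong y a≋b k = *-congʳ (a≋b k)

  dilate-⋆ : ∀ y a b → dilate y a ⋆ dilate y b ≋ dilate y (a ⋆ b)
  dilate-⋆ y a b k = trans (Σ≤-cong-≤ k term) (sym (*-distribʳ-Σ≤ k (pow y k) _))
    where
    term : ∀ {j} → j ≤ k → ofℕ (k C j) * (a j * pow y j * (b (k ∸ j) * pow y (k ∸ j)))
                              ≈ ofℕ (k C j) * (a j * b (k ∸ j)) * pow y k
    term {j} j≤k = begin
      ofℕ (k C j) * (a j * pow y j * (b (k ∸ j) * pow y (k ∸ j)))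
        ≈⟨ solve 5 (λ c x p z q → c :* (x :* p :* (z :* q)) := c :* (x :* z) :* (p :* q)) refl _ _ _ _ _ ⟩
      ofℕ (k C j) * (a j * b (k ∸ j)) * (pow y j * pow y (k ∸ j))
        ≈⟨ *-congˡ (pow-homo-+ y j (k ∸ j)) ⟨
      ofℕ (k C j) * (a j * b (k ∸ j)) * pow y (j ℕ.+ (k ∸ j))
        ≡⟨ ≡.cong (λ i → ofℕ (k C j) * (a j * b (k ∸ j)) * pow y i) (ℕ.m+[n∸m]≡n j≤k) ⟩
      ofℕ (k C j) * (a j * b (k ∸ j)) * pow y k ∎

  stirlingTransform-dilate-pow-⋆ : ∀ n u y e →
    stirlingTransform (dilate y (pow u ⋆ e)) n
      ≈ Σ≤ n (λ r → ofℕ (n C r) * φ r (u * y) * stirlingTransform (dilate y e) (n ∸ r))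
  stirlingTransform-dilate-pow-⋆ n u y e = begin
    stirlingTransform (dilate y (pow u ⋆ e)) n
      ≈⟨ stirlingTransform-cong n (λ k → trans (⋆-congˡ (dilate y e) (pow-distrib-* u y) k) (dilate-⋆ y (pow u) e k)) ⟨
    stirlingTransform (pow (u * y) ⋆ dilate y e) n
      ≈⟨ stirlingTransform-⋆ n (pow (u * y)) (dilate y e) ⟩
    Σ≤ n (λ r → ofℕ (n C r) * φ r (u * y) * stirlingTransform (dilate y e) (n ∸ r)) ∎

  factorial : Seq
  factorial m = ofℕ (m !)

  derangement : Seq
  derangement m = ofℤ (derange m)

  rencontres : Carrier → Seq
  rencontres z k = Σ≤ k (λ r → ofℤ (derangeFix k r) * pow z r)

  derangement≋pow[-1]⋆factorial : derangement ≋ pow (- 1#) ⋆ factorial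
  derangement≋pow[-1]⋆factorial m = trans (ofℤ-sumℤ m _) (Σ≤-cong-≤ m term)
    where
    term : ∀ {i} → i ≤ m → ofℤ (sgn i ℤ.* ℤ.+ (m P (m ∸ i))) ≈ ofℕ (m C i) * (pow (- 1#) i * factorial (m ∸ i))
    term {i} i≤m = begin
      ofℤ (sgn i ℤ.* ℤ.+ (m P (m ∸ i)))          ≈⟨ ofℤ-homo-* (sgn i) _ ⟩
      ofℤ (sgn i) * ofℕ (m P (m ∸ i))
        ≈⟨ *-cong (ofℤ-sgn i) (reflexive (≡.cong ofℕ (falling≡binomial*factorial i≤m))) ⟩
      pow (- 1#) i * ofℕ ((m C i) ℕ.* (m ∸ i) !) ≈⟨ *-congˡ (ofℕ-homo-* (m C i) ((m ∸ i) !)) ⟩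
      pow (- 1#) i * (ofℕ (m C i) * factorial (m ∸ i))
        ≈⟨ solve 3 (λ p c f → p :* (c :* f) := c :* (p :* f)) refl _ _ _ ⟩
      ofℕ (m C i) * (pow (- 1#) i * factorial (m ∸ i)) ∎

  ofℤ-derangeFix : ∀ k r → ofℤ (derangeFix k r) ≈ ofℕ (k C r) * derangement (k ∸ r)
  ofℤ-derangeFix k r = trans (reflexive (≡.cong ofℤ (derangeFix≡binomial*derange k r)))
                              (ofℤ-homo-* (ℤ.+ (k C r)) (derange (k ∸ r)))

  rencontres≋pow⋆derangement : ∀ z → rencontres z ≋ pow z ⋆ derangement
  rencontres≋pow⋆derangement z k = Σ≤-cong k (λ r → trans (*-congʳ (ofℤ-derangeFix k r))
    (solve 3 (λ c d p → c :* d :* p := c :* (p :* d)) refl _ _ _))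

  rencontres≋pow[z-1]⋆factorial : ∀ z → rencontres z ≋ pow (z - 1#) ⋆ factorial
  rencontres≋pow[z-1]⋆factorial z k = begin
    rencontres z k                               ≈⟨ rencontres≋pow⋆derangement z k ⟩
    (pow z ⋆ derangement) k                      ≈⟨ ⋆-congʳ (pow z) derangement≋pow[-1]⋆factorial k ⟩
    (pow z ⋆ (pow (- 1#) ⋆ factorial)) k         ≈⟨ pow-⋆-pow z (- 1#) factorial k ⟩
    (pow (z - 1#) ⋆ factorial) k                 ∎

  Σw̃≈stirlingTransform : ∀ n y z →
    Σ≤ n (λ r → w̃ n r y * pow z r) ≈ stirlingTransform (dilate y (rencontres z)) n
  Σw̃≈stirlingTransform n y z = begin
    Σ≤ n (λ r → w̃ n r y * pow z r)
      ≈⟨ Σ≤-cong n (λ r → trans (*-distribʳ-Σ≤ n (pow z r) _) (Σ≤-cong n (λ k →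
           solve 4 (λ s d p q → s :* d :* p :* q := s :* (d :* q :* p)) refl _ _ (pow y k) (pow z r)))) ⟩
    Σ≤ n (λ r → Σ≤ n (λ k → ofℕ (stirling2 n k) * X k r))
      ≈⟨ Σ≤-comm n n (λ r k → ofℕ (stirling2 n k) * X k r) ⟩
    Σ≤ n (λ k → Σ≤ n (λ r → ofℕ (stirling2 n k) * X k r))
      ≈⟨ Σ≤-cong-≤ n (λ {k} k≤n → trans (sym (*-distribˡ-Σ≤ n _ (X k))) (*-congˡ (inner k≤n))) ⟩
    stirlingTransform (dilate y (rencontres z)) n ∎
    where
    X : ℕ → ℕ → Carrier
    X k r = ofℤ (derangeFix k r) * pow z r * pow y k
    inner : ∀ {k} → k ≤ n → Σ≤ n (X k) ≈ dilate y (rencontres z) k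
    inner {k} k≤n = begin
      Σ≤ n (X k)                          ≈⟨ Σ≤-truncate (X k) vanish (ℕ.≤⇒≤′ k≤n) ⟩
      Σ≤ k (X k)                          ≈⟨ *-distribʳ-Σ≤ k (pow y k) _ ⟨
      dilate y (rencontres z) k           ∎
      where
      vanish : ∀ {r} → k < r → X k r ≈ 0#
      vanish {r} k<r = begin
        ofℤ (derangeFix k r) * pow z r * pow y k              ≈⟨ *-congʳ (*-congʳ (ofℤ-derangeFix k r)) ⟩
        ofℕ (k C r) * derangement (k ∸ r) * pow z r * pow y k
          ≡⟨ ≡.cong (λ c → ofℕ c * derangement (k ∸ r) * pow z r * pow y k) (k>n⇒nCk≡0 k<r) ⟩
        0# * derangement (k ∸ r) * pow z r * pow y k          ≈⟨ *-congʳ (*-congʳ (zeroˡ _)) ⟩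
        0# * pow z r * pow y k                                ≈⟨ *-congʳ (zeroˡ _) ⟩
        0# * pow y k                                          ≈⟨ zeroˡ _ ⟩
        0#                                                    ∎

  w≈stirlingTransform : ∀ m y → w m y ≈ stirlingTransform (dilate y factorial) m
  w≈stirlingTransform m y = Σ≤-cong m (λ k → trans (*-congʳ (ofℕ-homo-* (stirling2 m k) (k !))) (*-assoc _ _ _))

  w̃₀≈stirlingTransform : ∀ m y → w̃₀ m y ≈ stirlingTransform (dilate y derangement) m
  w̃₀≈stirlingTransform m y = Σ≤-cong m (λ k →
    trans (*-congʳ (*-congˡ (reflexive (≡.cong ofℤ (ℤ.*-identityˡ (derange k)))))) (*-assoc _ _ _))

  first-identity : ∀ n y z →
    Σ≤ n (λ r → w̃ n r y * pow z r) ≈ Σ≤ n (λ r → ofℕ (n C r) * φ r ((z - 1#) * y) * w (n ∸ r) y)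
  first-identity n y z = begin
    Σ≤ n (λ r → w̃ n r y * pow z r)
      ≈⟨ Σw̃≈stirlingTransform n y z ⟩
    stirlingTransform (dilate y (rencontres z)) n
      ≈⟨ stirlingTransform-cong n (dilate-cong y (rencontres≋pow[z-1]⋆factorial z)) ⟩
    stirlingTransform (dilate y (pow (z - 1#) ⋆ factorial)) n
      ≈⟨ stirlingTransform-dilate-pow-⋆ n (z - 1#) y factorial ⟩
    Σ≤ n (λ r → ofℕ (n C r) * φ r ((z - 1#) * y) * stirlingTransform (dilate y factorial) (n ∸ r))
      ≈⟨ Σ≤-cong n (λ r → *-congˡ (w≈stirlingTransform (n ∸ r) y)) ⟨
    Σ≤ n (λ r → ofℕ (n C r) * φ r ((z - 1#) * y) * w (n ∸ r) y) ∎

  second-identity : ∀ n y z →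
    Σ≤ n (λ r → w̃ n r y * pow z r) ≈ Σ≤ n (λ r → ofℕ (n C r) * φ r (z * y) * w̃₀ (n ∸ r) y)
  second-identity n y z = begin
    Σ≤ n (λ r → w̃ n r y * pow z r)
      ≈⟨ Σw̃≈stirlingTransform n y z ⟩
    stirlingTransform (dilate y (rencontres z)) n
      ≈⟨ stirlingTransform-cong n (dilate-cong y (rencontres≋pow⋆derangement z)) ⟩
    stirlingTransform (dilate y (pow z ⋆ derangement)) n
      ≈⟨ stirlingTransform-dilate-pow-⋆ n z y derangement ⟩
    Σ≤ n (λ r → ofℕ (n C r) * φ r (z * y) * stirlingTransform (dilate y derangement) (n ∸ r))
      ≈⟨ Σ≤-cong n (λ r → *-congˡ (w̃₀≈stirlingTransform (n ∸ r) y)) ⟨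
    Σ≤ n (λ r → ofℕ (n C r) * φ r (z * y) * w̃₀ (n ∸ r) y) ∎

open import Data.Product using (_×_)
open CommutativeRing using (Carrier; _≈_; _*_; _-_; 1#)
open Poly using (Σ≤; w̃; pow; ofℕ; φ; w; w̃₀)

mainTheorem12 : {c ℓ : Level} (R : CommutativeRing c ℓ) (n : ℕ) (y z : Carrier R) →
    (_≈_ R (Σ≤ R n (λ r → _*_ R (w̃ R n r y) (pow R z r)))
           (Σ≤ R n (λ r → _*_ R (_*_ R (ofℕ R (n C r)) (φ R r (_*_ R (_-_ R z (1# R)) y))) (w R (n ∸ r) y))))
    × (_≈_ R (Σ≤ R n (λ r → _*_ R (w̃ R n r y) (pow R z r)))
             (Σ≤ R n (λ r → _*_ R (_*_ R (ofℕ R (n C r)) (φ R r (_*_ R z y))) (w̃₀ R (n ∸ r) y))))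
mainTheorem12 R n y z = first-identity R n y z , second-identity R n y z
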